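{- Let $\mathbf{c}=1\,0^{\mu_1}\,1\,0^{\mu_2}\,1\cdots$ be a zero-one sequence beginning with $1$ with infinitely many $1$'s, let $S=\theta(\mathbf{c})=\{S_0<S_1<\cdots\}$, and for $n\ge1$ let $\alpha_n$ be the number of integers $i$ with $S_{n-1}<i<S_n$ and $i\in S+S$. Put $g(n)=\mu_n+\alpha_n$ and $h(n)=\sum_{i=1}^{2^{n-1}}g(i)+2^{n-1}$ for $n\ge1$. Let $m\ge1$ and suppose $g(2^k+i)=g(i)$ for all $0\le k<m$ and $0<i<2^k$. Then \[ h(m+1)=\sum_{i=1}^m h(i)+g(2^m)+1. \]
   Context: $0^{\mu}$ denotes a block of $\mu\ge0$ zeros, so $\mu_n$ is the number of $0$'s between the $n$-th and $(n+1)$-th $1$ of $\mathbf{c}$. A set $S$ of positive integers is sum-free if there are no $x,y,z\in S$ ($x,y$ not necessarily distinct) with $x+y=z$. Cameron's bijection $\theta$: given a zero-one sequence $\mathbf{w}$, examine $n=1,2,\dots$ in order; if $n=x+y$ for some $x,y$ already in $S$, label $n$ by $\ast$ ($n\notin S$); otherwise read the next unread symbol of $\mathbf{w}$ and put $n\in S$ iff it is $1$. Then $\theta(\mathbf{w})=S$, listed increasingly as $S_0<S_1<\cdots$. -}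

module Defs where

open import Data.Bool using (Bool; true; false; if_then_else_; not; _∧_)
open import Data.Nat using (ℕ; zero; suc; _+_; _∸_; _^_; _≡ᵇ_; _<_)
open import Data.List using (List; []; _∷_; upTo)
open import Data.Bool.ListAction using (any)
open import Data.Product using (_×_; _,_; proj₁; ∃-syntax)
open import Function.Bundles using (_⇔_)
open import Relation.Binary.PropositionalEquality using (_≡_)

-- A zero-one sequence w is a function ℕ → Bool; w 0 is its first symbol,
-- true = 1, false = 0.

isSumList : List ℕ → ℕ → Bool
isSumList L z = any (λ x → any (λ y → x + y ≡ᵇ z) L) L

-- One step of Cameron's procedure for the integer n:
-- state = (elements of S found so far, index of next unread symbol of w).
step : (ℕ → Bool) → ℕ → List ℕ × ℕ → List ℕ × ℕ
step w n (L , p) =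
  if isSumList L n then (L , p)
  else (if w p then (n ∷ L , suc p) else (L , suc p))

state : (ℕ → Bool) → ℕ → List ℕ × ℕ
state w zero = ([] , 0)
state w (suc n) = step w (suc n) (state w n)

inθ : (ℕ → Bool) → ℕ → Bool
inθ w zero = false
inθ w (suc n) = any (λ x → x ≡ᵇ suc n) (proj₁ (state w (suc n)))

inSumSet : (ℕ → Bool) → ℕ → Bool
inSumSet w i =
  any (λ x → any (λ y → inθ w x ∧ inθ w y ∧ (x + y ≡ᵇ i)) (upTo (suc i))) (upTo (suc i))

StrictEnum : (ℕ → ℕ) → (ℕ → Set) → Set
StrictEnum f P = (∀ k → f k < f (suc k)) × (∀ x → P x ⇔ (∃[ k ] f k ≡ x))

countFrom : (ℕ → Bool) → ℕ → ℕ → ℕ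
countFrom P lo zero = 0
countFrom P lo (suc k) = (if P lo then 1 else 0) + countFrom P (suc lo) k

countBetween : (ℕ → Bool) → ℕ → ℕ → ℕ
countBetween P a b = countFrom P (suc a) (b ∸ suc a)

sum1 : (ℕ → ℕ) → ℕ → ℕ
sum1 f zero = 0
sum1 f (suc N) = sum1 f N + f (suc N)

-- pos enumerates the positions of the 1's of c (pos 0 = position of the 1st one),
-- s enumerates S = θ(c) (s k = S_k).
-- μ_n (n ≥ 1): number of 0's between the n-th and (n+1)-th 1 of c.
μ : (c : ℕ → Bool) → (pos : ℕ → ℕ) → ℕ → ℕ
μ c pos n = countBetween (λ i → not (c i)) (pos (n ∸ 1)) (pos n)

α : (c : ℕ → Bool) → (s : ℕ → ℕ) → ℕ → ℕ
α c s n = countBetween (inSumSet c) (s (n ∸ 1)) (s n)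

g : (c : ℕ → Bool) → (pos s : ℕ → ℕ) → ℕ → ℕ
g c pos s n = μ c pos n + α c s n

h : (c : ℕ → Bool) → (pos s : ℕ → ℕ) → ℕ → ℕ
h c pos s n = sum1 (g c pos s) (2 ^ (n ∸ 1)) + 2 ^ (n ∸ 1)

{-# OPTIONS --safe #-}
module Submission where

-- With D k = Σ_{i=1}^{2^k} f(i), the self-similarity f(2^k + i) = f(i) for 0 < i < 2^k
-- says that the second half of the block [1, 2^(k+1)] repeats the first half except at
-- its last point, so D (k+1) = 2 D k − f(2^k) + f(2^(k+1)). Unfolding this recurrence
-- gives D k = Σ_{j<k} D j + f(2^k). Since h(n) = D (n−1) + 2^(n−1), summing h over
-- 1..m gives Σ_{j<m} D j + 2^m − 1, and h(m+1) = D m + 2^m finishes the identity.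
-- Nothing about θ, c or S is used: the identity holds for every f : ℕ → ℕ with this
-- self-similarity, with f = g.

open import Defs
open import Data.Bool using (Bool; true)
open import Data.Nat using (ℕ; zero; suc; _+_; _*_; _∸_; _^_; _≤_; _<_; s≤s; z≤n)
open import Data.Nat.Properties
open import Data.Product using (_×_; ∃-syntax)
open import Relation.Binary.PropositionalEquality
open import Data.Nat.Tactic.RingSolver using (solve-∀)

sum1-+ : ∀ (u v : ℕ → ℕ) N → sum1 (λ i → u i + v i) N ≡ sum1 u N + sum1 v N
sum1-+ u v zero = refl
sum1-+ u v (suc N) rewrite sum1-+ u v N = rearrange (sum1 u N) (sum1 v N) (u (suc N)) (v (suc N))
  where
  rearrange : ∀ a b x y → a + b + (x + y) ≡ a + x + (b + y)
  rearrange = solve-∀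

sum1-++ : ∀ f M N → sum1 f (M + N) ≡ sum1 f M + sum1 (λ i → f (M + i)) N
sum1-++ f M zero = trans (cong (sum1 f) (+-identityʳ M)) (sym (+-identityʳ _))
sum1-++ f M (suc N) rewrite +-suc M N | sum1-++ f M N = +-assoc (sum1 f M) _ _

sum1-shift : ∀ f q → (∀ i → 0 < i → i < q → f (q + i) ≡ f i) →
             ∀ N → N < q → sum1 (λ i → f (q + i)) N ≡ sum1 f N
sum1-shift f q periodic zero _ = refl
sum1-shift f q periodic (suc N) N<q =
  cong₂ _+_ (sum1-shift f q periodic N (<-trans (n<1+n N) N<q)) (periodic (suc N) (s≤s z≤n) N<q)

sum1-pow2 : ∀ m → sum1 (λ n → 2 ^ (n ∸ 1)) m + 1 ≡ 2 ^ m
sum1-pow2 zero = refl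
sum1-pow2 (suc m) = begin
  sum1 (λ n → 2 ^ (n ∸ 1)) m + 2 ^ m + 1   ≡⟨ rearrange (sum1 _ m) (2 ^ m) ⟩
  sum1 (λ n → 2 ^ (n ∸ 1)) m + 1 + 2 ^ m   ≡⟨ cong (_+ 2 ^ m) (sum1-pow2 m) ⟩
  2 ^ m + 2 ^ m                            ≡˘⟨ cong (2 ^ m +_) (+-identityʳ (2 ^ m)) ⟩
  2 ^ suc m                                ∎
  where
  open ≡-Reasoning
  rearrange : ∀ a t → a + t + 1 ≡ a + 1 + t
  rearrange = solve-∀

sum1-double : ∀ f q → 0 < q → (∀ i → 0 < i → i < q → f (q + i) ≡ f i) →
              sum1 f (2 * q) + f q ≡ sum1 f q + sum1 f q + f (2 * q)
sum1-double f q@(suc p) _ periodic = begin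
  sum1 f (2 * q) + f q                                    ≡⟨ cong (λ t → sum1 f (q + t) + f q) (+-identityʳ q) ⟩
  sum1 f (q + q) + f q                                    ≡⟨ cong (_+ f q) (sum1-++ f q q) ⟩
  sum1 f q + (sum1 (λ i → f (q + i)) p + f (q + q)) + f q ≡⟨ cong (λ t → sum1 f q + (t + f (q + q)) + f q) shifted ⟩
  sum1 f q + (sum1 f p + f (q + q)) + f q                 ≡⟨ rearrange (sum1 f q) (sum1 f p) (f (q + q)) (f q) ⟩
  sum1 f q + sum1 f q + f (q + q)                         ≡˘⟨ cong (λ t → sum1 f q + sum1 f q + f (q + t)) (+-identityʳ q) ⟩
  sum1 f q + sum1 f q + f (2 * q)                         ∎
  where
  open ≡-Reasoning
  shifted : sum1 (λ i → f (q + i)) p ≡ sum1 f p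
  shifted = sum1-shift f q periodic p ≤-refl
  rearrange : ∀ a b x y → a + (b + x) + y ≡ a + (b + y) + x
  rearrange = solve-∀

SelfSimilarBelow : (ℕ → ℕ) → ℕ → Set
SelfSimilarBelow f m = ∀ k i → k < m → 0 < i → i < 2 ^ k → f (2 ^ k + i) ≡ f i

dyadicSum-recurrence : ∀ f m → SelfSimilarBelow f m → ∀ k → k ≤ m →
  sum1 f (2 ^ k) ≡ sum1 (λ n → sum1 f (2 ^ (n ∸ 1))) k + f (2 ^ k)
dyadicSum-recurrence f m selfSimilar zero _ = refl
dyadicSum-recurrence f m selfSimilar (suc k) k<m = +-cancelʳ-≡ (f q) _ _ (begin
  D (suc k) + f q             ≡⟨ sum1-double f q (m^n>0 2 k) (λ i → selfSimilar k i k<m) ⟩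
  D k + D k + f (2 * q)       ≡⟨ cong (λ t → D k + t + f (2 * q)) recurrence-k ⟩
  D k + (B + f q) + f (2 * q) ≡⟨ rearrange (D k) B (f q) (f (2 * q)) ⟩
  B + D k + f (2 * q) + f q   ∎)
  where
  open ≡-Reasoning
  q : ℕ
  q = 2 ^ k
  D : ℕ → ℕ
  D j = sum1 f (2 ^ j)
  B : ℕ
  B = sum1 (λ n → D (n ∸ 1)) k
  recurrence-k : D k ≡ B + f q
  recurrence-k = dyadicSum-recurrence f m selfSimilar k (<⇒≤ k<m)
  rearrange : ∀ d b x y → d + (b + x) + y ≡ b + d + y + x
  rearrange = solve-∀

mainTheorem3 : (c : ℕ → Bool) → c 0 ≡ true
    → (∀ n → ∃[ j ] (n ≤ j × c j ≡ true))
    → (pos : ℕ → ℕ) → StrictEnum pos (λ i → c i ≡ true)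
    → (s : ℕ → ℕ) → StrictEnum s (λ x → inθ c x ≡ true)
    → (m : ℕ) → 1 ≤ m
    → (∀ k i → k < m → 0 < i → i < 2 ^ k → g c pos s (2 ^ k + i) ≡ g c pos s i)
    → h c pos s (suc m) ≡ sum1 (h c pos s) m + g c pos s (2 ^ m) + 1
mainTheorem3 c _ _ pos _ s _ m _ selfSimilar = begin
  D m + 2 ^ m                        ≡⟨ cong (_+ 2 ^ m) (dyadicSum-recurrence f m selfSimilar m ≤-refl) ⟩
  B + f (2 ^ m) + 2 ^ m              ≡˘⟨ cong (B + f (2 ^ m) +_) (sum1-pow2 m) ⟩
  B + f (2 ^ m) + (P + 1)            ≡⟨ rearrange B (f (2 ^ m)) P ⟩
  B + P + f (2 ^ m) + 1              ≡˘⟨ cong (λ t → t + f (2 ^ m) + 1) (sum1-+ (λ n → D (n ∸ 1)) (λ n → 2 ^ (n ∸ 1)) m) ⟩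
  sum1 (h c pos s) m + f (2 ^ m) + 1 ∎
  where
  open ≡-Reasoning
  f : ℕ → ℕ
  f = g c pos s
  D : ℕ → ℕ
  D j = sum1 f (2 ^ j)
  B P : ℕ
  B = sum1 (λ n → D (n ∸ 1)) m
  P = sum1 (λ n → 2 ^ (n ∸ 1)) m
  rearrange : ∀ b x p → b + x + (p + 1) ≡ b + p + x + 1
  rearrange = solve-∀
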